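{- There is no SLCS formula $\varphi$ such that for every neighbourhood model $\mathcal{M}$, the underlying space of $\mathcal{M}$ is $T_1$-separated if and only if $\mathcal{M},x\models\varphi$ for every point $x$ of $\mathcal{M}$.
   Context: A neighbourhood space $(X,\mathcal{N})$ assigns to each $x\in X$ a filter $\mathcal{N}(x)$ on $X$ (non-empty-intersection-closed, upward closed, not containing $\emptyset$) with $x\in N$ for all $N\in\mathcal{N}(x)$. Closure: $\mathcal{C}(A)=\{x\mid\forall N\in\mathcal{N}(x): A\cap N\ne\emptyset\}$. Continuity of $f$: for all $x$ and $N_2\in\mathcal{N}_2(f(x))$, $f^{ -1}[N_2]\in\mathcal{N}_1(x)$. Sets $U,V$ are semi-separated if $\mathcal{C}(U)\cap V=U\cap\mathcal{C}(V)=\emptyset$; connected = not a union of two non-empty semi-separated sets. An index space $(I,\mathcal{N}_I,\le,0)$ is a connected neighbourhood space with a linear order with least element $0$; a path is a continuous map from the index space into the space. A neighbourhood model is $((X,\mathcal{N}),\mathcal{I},V)$ with $\mathcal{I}$ an index space and $V:X\to\mathcal{P}(\mathsf{P})$ a valuation of atoms. SLCS formulas: $\varphi::=a\mid\top\mid\neg\varphi\mid\varphi\wedge\varphi\mid\mathcal{N}\varphi\mid\varphi\,\mathcal{R}\,\varphi\mid\varphi\,\mathcal{P}\,\varphi$, with semantics: $x\models a$ iff $a\in V(x)$; Booleans as usual; $x\models\mathcal{N}\varphi$ iff $x\in\mathcal{C}(\{y\mid y\models\varphi\})$; $x\models\varphi\,\mathcal{R}\,\psi$ iff there are a path $p$ and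 $n$ with $p(n)=x$, $p(0)\models\psi$ and $p(i)\models\varphi$ for all $0<i\le n$; $x\models\varphi\,\mathcal{P}\,\psi$ iff there are a path $p$ with $p(0)=x$ and $n$ with $p(n)\models\psi$ and $p(i)\models\varphi$ for all $0\le i<n$. A space is $T_1$-separated if for all distinct points $x,y$: $\{x\}\cap\mathcal{C}(\{y\})=\mathcal{C}(\{x\})\cap\{y\}=\emptyset$. -}

module Defs where

open import Level using (Lift; lift)
open import Agda.Primitive using (lzero; lsuc)
open import Data.Unit.Polymorphic using (⊤)
open import Data.Product using (Σ; ∃; _×_; _,_; proj₁)
open import Data.Sum using (_⊎_)
open import Data.Empty using (⊥)
open import Relation.Nullary using (¬_)
open import Relation.Binary.PropositionalEquality using (_≡_)
open import Relation.Binary.Structures using (IsTotalOrder)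

Subset : Set → Set₁
Subset X = X → Set

_∈_ : {X : Set} → X → Subset X → Set
x ∈ A = A x

_⊆_ : {X : Set} → Subset X → Subset X → Set
A ⊆ B = ∀ x → A x → B x

_∩_ : {X : Set} → Subset X → Subset X → Subset X
(A ∩ B) x = A x × B x

record IsFilter {X : Set} (F : Subset X → Set) : Set₁ where
  field
    nonempty      : Σ (Subset X) F
    ∩-closed      : ∀ A B → F A → F B → F (A ∩ B)
    upward-closed : ∀ A B → F A → A ⊆ B → F B
    no-empty      : ∀ A → F A → Σ X A

record NeighbourhoodSpace (X : Set) : Set₁ where
  field
    𝒩        : X → Subset X → Set
    isFilter : ∀ x → IsFilter (𝒩 x)
    centred  : ∀ x N → 𝒩 x N → x ∈ N

module _ {X : Set} (S : NeighbourhoodSpace X) where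
  open NeighbourhoodSpace S

  𝒞 : Subset X → X → Set₁
  𝒞 A x = ∀ N → 𝒩 x N → Σ X (λ y → A y × N y)

  SemiSeparated : Subset X → Subset X → Set₁
  SemiSeparated U V = (∀ x → ¬ (𝒞 U x × V x)) × (∀ x → ¬ (U x × 𝒞 V x))

  Connected : Set₁
  Connected = ¬ (Σ (Subset X) λ U → Σ (Subset X) λ V →
                   Σ X U × Σ X V × SemiSeparated U V × (∀ x → U x ⊎ V x))

  T₁ : Set₁
  T₁ = ∀ x y → ¬ x ≡ y →
         (∀ z → ¬ (z ≡ x × 𝒞 (λ w → w ≡ y) z)) ×
         (∀ z → ¬ (𝒞 (λ w → w ≡ x) z × z ≡ y))

Continuous : {X Y : Set} → NeighbourhoodSpace X → NeighbourhoodSpace Y →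
             (X → Y) → Set₁
Continuous S₁ S₂ f =
  ∀ x (N₂ : Subset _) → NeighbourhoodSpace.𝒩 S₂ (f x) N₂ →
    NeighbourhoodSpace.𝒩 S₁ x (λ x′ → N₂ (f x′))

record IndexSpace : Set₁ where
  field
    I           : Set
    space       : NeighbourhoodSpace I
    connected   : Connected space
    _≤_         : I → I → Set
    isTotalOrder : IsTotalOrder _≡_ _≤_
    0ᵢ          : I
    least       : ∀ i → 0ᵢ ≤ i

record NeighbourhoodModel (P : Set) : Set₁ where
  field
    X     : Set
    space : NeighbourhoodSpace X
    index : IndexSpace
    V     : X → P → Set

data Formula (P : Set) : Set where
  atom : P → Formula P
  ⊤ᶠ   : Formula P
  ¬ᶠ_  : Formula P → Formula P
  _∧ᶠ_ : Formula P → Formula P → Formula P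
  𝓝    : Formula P → Formula P
  _𝓡_  : Formula P → Formula P → Formula P
  _𝓟_  : Formula P → Formula P → Formula P

module _ {P : Set} (M : NeighbourhoodModel P) where
  open NeighbourhoodModel M
  open IndexSpace index renaming (space to Ispace)

  _<ᵢ_ : I → I → Set
  i <ᵢ j = i ≤ j × ¬ i ≡ j

  Path : Set₁
  Path = Σ (I → X) (Continuous Ispace space)

  _⊨_ : X → Formula P → Set₁
  x ⊨ atom a = Lift (lsuc lzero) (V x a)
  x ⊨ ⊤ᶠ = ⊤
  x ⊨ (¬ᶠ φ) = ¬ (x ⊨ φ)
  x ⊨ (φ ∧ᶠ ψ) = (x ⊨ φ) × (x ⊨ ψ)
  -- x ⊨ 𝓝 φ iff x ∈ 𝒞({y | y ⊨ φ}) (closure unfolded, as ⊨ lives in Set₁)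
  x ⊨ 𝓝 φ = ∀ N → NeighbourhoodSpace.𝒩 space x N → Σ X (λ y → (y ⊨ φ) × N y)
  x ⊨ (φ 𝓡 ψ) = Σ Path λ p → Σ I λ n →
                 (proj₁ p n ≡ x) × (proj₁ p 0ᵢ ⊨ ψ) ×
                 (∀ i → 0ᵢ <ᵢ i → i ≤ n → proj₁ p i ⊨ φ)
  x ⊨ (φ 𝓟 ψ) = Σ Path λ p → Σ I λ n →
                 (proj₁ p 0ᵢ ≡ x) × (proj₁ p n ⊨ ψ) ×
                 (∀ i → 0ᵢ ≤ i → i <ᵢ n → proj₁ p i ⊨ φ)

module Submission where

-- Idea: in an indiscrete space every neighbourhood of a point is the whole
-- space, so closures of non-empty sets are everything and every map into it
-- is continuous.  Hence, for models whose space is indiscrete, whose index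
-- space is the one-point space and whose valuation does not depend on the
-- point, the truth of a formula does not depend on the point, nor on the
-- carrier: any two points of any two such models satisfy the same formulas
-- (lemma `transfer`, by induction on the formula).
--
-- The one-point indiscrete space is T₁ (all its points are equal), whereas
-- the indiscrete space on two distinct points is not.  A formula defining
-- T₁ would hold everywhere in the first model, hence by `transfer` everywhere
-- in the second, making the second space T₁ — a contradiction.

open import Defs
open import Data.Product using (Σ; _,_; proj₁; proj₂)
open import Relation.Nullary using (¬_)
open import Function.Bundles using (_⇔_; Equivalence)
open import Data.Unit using (tt) renaming (⊤ to Unit)
open import Data.Unit.Properties using (≡-isTotalOrder)
open import Data.Bool using (Bool; true; false)
open import Data.Empty using (⊥; ⊥-elim)
open import Relation.Binary.PropositionalEquality using (_≡_; refl)
open import Level using (lift; lower)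

indiscrete : (X : Set) → NeighbourhoodSpace X
indiscrete X = record
  { 𝒩 = λ _ N → ∀ y → N y
  ; isFilter = λ x → record
      { nonempty      = (λ _ → Unit) , (λ _ → tt)
      ; ∩-closed      = λ A B a b y → a y , b y
      ; upward-closed = λ A B a A⊆B y → A⊆B y (a y)
      ; no-empty      = λ A a → x , a x }
  ; centred = λ x N n → n x }

-- Every map into an indiscrete space is continuous: the preimage of the
-- whole space is the whole space, which is a neighbourhood of every point
-- (it contains some neighbourhood, filters being non-empty and upward closed).
continuous-into-indiscrete : ∀ {X Y} (S : NeighbourhoodSpace X) (f : X → Y) →
                             Continuous S (indiscrete Y) f
continuous-into-indiscrete S f x N whole =
  upward-closed A (λ x′ → N (f x′)) A∈𝒩x (λ x′ _ → whole (f x′))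
  where
  open IsFilter (NeighbourhoodSpace.isFilter S x)
  A : Subset _
  A = proj₁ nonempty
  A∈𝒩x : NeighbourhoodSpace.𝒩 S x A
  A∈𝒩x = proj₂ nonempty

-- Indiscrete spaces are connected: a point of V lies in the closure of a
-- non-empty U, so U and V cannot be semi-separated.
indiscrete-connected : (X : Set) → Connected (indiscrete X)
indiscrete-connected X (U , V , (u , u∈U) , (v , v∈V) , (U̅∩V≡∅ , _) , _) =
  U̅∩V≡∅ v ((λ N whole → u , u∈U , whole u) , v∈V)

-- Two distinct points of an indiscrete space lie in each other's closure,
-- so an indiscrete space with two distinct points is not T₁.
indiscrete-not-T₁ : ∀ {X} (x y : X) → ¬ x ≡ y → ¬ T₁ (indiscrete X)
indiscrete-not-T₁ x y x≢y t₁ =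
  proj₂ (t₁ x y x≢y) y ((λ N whole → x , refl , whole x) , refl)

subsingleton-T₁ : ∀ {X} (S : NeighbourhoodSpace X) → (∀ (x y : X) → x ≡ y) → T₁ S
subsingleton-T₁ S all-equal x y x≢y = ⊥-elim (x≢y (all-equal x y))

pointIndex : IndexSpace
pointIndex = record
  { I            = Unit
  ; space        = indiscrete Unit
  ; connected    = indiscrete-connected Unit
  ; _≤_          = _≡_
  ; isTotalOrder = ≡-isTotalOrder
  ; 0ᵢ           = tt
  ; least        = λ _ → refl }

indiscreteModel : {P : Set} (X : Set) (v : P → Set) → NeighbourhoodModel P
indiscreteModel X v = record
  { X = X ; space = indiscrete X ; index = pointIndex ; V = λ _ → v }

transfer : ∀ {P} {v : P → Set} {X Y : Set} (φ : Formula P) (x : X) (y : Y) →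
           _⊨_ (indiscreteModel X v) x φ → _⊨_ (indiscreteModel Y v) y φ
transfer (atom a) x y x⊨a = lift (lower x⊨a)
transfer ⊤ᶠ x y x⊨⊤ = x⊨⊤
transfer (¬ᶠ φ) x y x⊭φ y⊨φ = x⊭φ (transfer φ y x y⊨φ)
transfer (φ ∧ᶠ ψ) x y (x⊨φ , x⊨ψ) = transfer φ x y x⊨φ , transfer ψ x y x⊨ψ
-- Taking the whole space as neighbourhood yields a witness of φ, which
-- transfers to y; y then lies in every neighbourhood of y.
transfer (𝓝 φ) x y x⊨𝓝φ N whole with x⊨𝓝φ (λ _ → Unit) (λ _ → tt)
... | z , z⊨φ , _ = y , transfer φ z y z⊨φ , whole y
-- The start of the given path satisfies ψ; the constant path at y, of
-- length 0, then witnesses both 𝓡 and 𝓟 at y: the one-point index space has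
-- no index strictly between 0 and 0, so the conditions on φ are vacuous.
transfer (φ 𝓡 ψ) x y ((p , _) , _ , _ , p0⊨ψ , _) =
  ((λ _ → y) , continuous-into-indiscrete (indiscrete Unit) _) , tt , refl ,
  transfer ψ (p tt) y p0⊨ψ , λ i 0<i _ → ⊥-elim (proj₂ 0<i refl)
transfer (φ 𝓟 ψ) x y ((p , _) , n , _ , pn⊨ψ , _) =
  ((λ _ → y) , continuous-into-indiscrete (indiscrete Unit) _) , tt , refl ,
  transfer ψ (p n) y pn⊨ψ , λ i _ i<0 → ⊥-elim (proj₂ i<0 refl)

proposition20 : (P : Set) → ¬ (Σ (Formula P) λ φ →
    (M : NeighbourhoodModel P) →
    T₁ (NeighbourhoodModel.space M) ⇔
    (∀ x → _⊨_ M x φ))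
proposition20 P (φ , defines-T₁) =
  indiscrete-not-T₁ true false (λ ()) two-points-T₁
  where
  empty : P → Set
  empty _ = ⊥

  point⊨φ : _⊨_ (indiscreteModel Unit empty) tt φ
  point⊨φ = Equivalence.to (defines-T₁ (indiscreteModel Unit empty))
              (subsingleton-T₁ (indiscrete Unit) (λ _ _ → refl)) tt

  two-points-T₁ : T₁ (indiscrete Bool)
  two-points-T₁ = Equivalence.from (defines-T₁ (indiscreteModel Bool empty))
                    (λ b → transfer φ tt b point⊨φ)
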